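{- For each integer $b\ge 2$, there are infinitely many pairs $(y,w)$, where $y$ is a positive integer and $w$ is a word over $\{0,1,\dots,b-1\}$, such that $(y^2)_b = w\uparrow 2$.
   Context: $(m)_b$ denotes the canonical base-$b$ representation of the integer $m$ (no leading zeros); $w\uparrow n$ is the concatenation of $n$ copies of the word $w$. -}

module Defs where

open import Data.Nat using (ℕ; zero; suc; _+_; _*_)
open import Data.Fin using (Fin; toℕ)
open import Data.List using (List; []; _∷_; _++_; foldl)
open import Data.Product using (_×_)
open import Relation.Binary.PropositionalEquality using (_≡_; _≢_)

-- A word over the alphabet {0,…,b-1}: a list of digits, most significant first.
Word : ℕ → Set
Word b = List (Fin b)

value : {b : ℕ} → Word b → ℕ
value {b} = foldl (λ acc d → acc * b + toℕ d) 0

_↑_ : {A : Set} → List A → ℕ → List A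
w ↑ zero = []
w ↑ suc n = w ++ (w ↑ n)

-- IsRep b m ds : ds is the canonical base-b representation (m)_b of m,
-- i.e. digits in {0,…,b-1}, no leading zero, and value m.
-- (Only used for positive m here; for positive m this is exactly (m)_b.)
data IsRep (b : ℕ) (m : ℕ) : Word b → Set where
  rep : (d : Fin b) (ds : Word b) → toℕ d ≢ 0 → value (d ∷ ds) ≡ m →
        IsRep b m (d ∷ ds)

{-# OPTIONS --safe #-}
-- If q ≥ 4 and A q² = b^k + 1, put v = A (q − 1)² and y = A q (q − 1). Then
-- y² = v A q² = v b^k + v, and b^(k−1) < v < b^k because (q − 1)² < q² ≤ 2 (q − 1)²;
-- so (y²)_b is the k-digit expansion of v written twice. Such q exist beyond every
-- bound: for z = b^n the odd number q = z² − z + 1 divides x + 1 with x = z³, and an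
-- odd q dividing x + 1 satisfies x^q + 1 ≡ q (x + 1) ≡ 0 (mod q²).
module Submission where

open import Defs
open import Data.Nat
open import Data.Nat.Properties
open import Data.Nat.DivMod using (_/_; _%_; _mod_; m≡m%n+[m/n]*n; m%n<n; m<n*o⇒m/o<n)
open import Data.Nat.Divisibility using (_∣_; divides; ∣-refl; ∣-trans; *-pres-∣; m∣m*n; ∣m∣n⇒∣m+n; ∣m+n∣m⇒∣n)
open import Data.Nat.Tactic.RingSolver using (solve-∀)
open import Data.Fin using (toℕ)
open import Data.Fin.Properties using (toℕ<n; toℕ-fromℕ<)
open import Data.List using ([]; _∷_; _++_; foldl; length; [_])
open import Data.List.Properties using (foldl-++; length-++; ++-identityʳ)
open import Data.Product using (Σ; ∃; ∃₂; _×_; _,_)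
open import Relation.Binary.PropositionalEquality hiding ([_])
open import Relation.Nullary using (contradiction)

module _ {b : ℕ} where

  value-foldl : ∀ acc (ds : Word b) →
    foldl (λ acc d → acc * b + toℕ d) acc ds ≡ acc * b ^ length ds + value ds
  value-foldl acc [] = sym (trans (+-identityʳ (acc * 1)) (*-identityʳ acc))
  value-foldl acc (d ∷ ds) = begin
    foldl _ (acc * b + toℕ d) ds                        ≡⟨ value-foldl (acc * b + toℕ d) ds ⟩
    (acc * b + toℕ d) * b ^ length ds + value ds        ≡⟨ shift-digit acc b (toℕ d) (b ^ length ds) (value ds) ⟩
    acc * b ^ suc (length ds) + ((0 * b + toℕ d) * b ^ length ds + value ds)
      ≡⟨ cong (acc * b ^ suc (length ds) +_) (value-foldl (0 * b + toℕ d) ds) ⟨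
    acc * b ^ suc (length ds) + value (d ∷ ds)          ∎
    where
    open ≡-Reasoning
    shift-digit : ∀ a b d p v → (a * b + d) * p + v ≡ a * (b * p) + ((0 * b + d) * p + v)
    shift-digit = solve-∀

  value-∷ : ∀ d (ds : Word b) → value (d ∷ ds) ≡ toℕ d * b ^ length ds + value ds
  value-∷ d = value-foldl (toℕ d)

  value-++ : ∀ (w v : Word b) → value (w ++ v) ≡ value w * b ^ length v + value v
  value-++ w v = trans (foldl-++ _ 0 w v) (value-foldl (value w) v)

  value<b^length : ∀ (ds : Word b) → value ds < b ^ length ds
  value<b^length [] = s≤s z≤n
  value<b^length (d ∷ ds) = begin-strict
    value (d ∷ ds)        ≡⟨ value-∷ d ds ⟩
    toℕ d * P + value ds  <⟨ +-monoʳ-< (toℕ d * P) (value<b^length ds) ⟩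
    toℕ d * P + P         ≡⟨ +-comm (toℕ d * P) P ⟩
    suc (toℕ d) * P       ≤⟨ *-monoˡ-≤ P (toℕ<n d) ⟩
    b * P                 ∎
    where
    open ≤-Reasoning
    P = b ^ length ds

  leading-digit≢0 : ∀ d (ds : Word b) → b ^ length ds < value (d ∷ ds) → toℕ d ≢ 0
  leading-digit≢0 d ds lower d≡0 = <-asym lower (begin-strict
    value (d ∷ ds)                        ≡⟨ value-∷ d ds ⟩
    toℕ d * b ^ length ds + value ds      ≡⟨ cong (λ c → c * b ^ length ds + value ds) d≡0 ⟩
    value ds                              <⟨ value<b^length ds ⟩
    b ^ length ds                         ∎)
    where open ≤-Reasoning

  value-↑2 : ∀ (w : Word b) → value (w ↑ 2) ≡ value w * b ^ length w + value w
  value-↑2 w = trans (cong (λ u → value (w ++ u)) (++-identityʳ w)) (value-++ w w)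

  isRep-↑2 : ∀ (w : Word b) → b ^ length w < b * value w → IsRep b (value (w ↑ 2)) (w ↑ 2)
  isRep-↑2 []       lower = contradiction (subst (1 <_) (*-zeroʳ b) lower) n≮0
  isRep-↑2 (d ∷ ds) lower = rep d _ (leading-digit≢0 d ds (*-cancelˡ-< b _ _ lower)) refl

module _ (b : ℕ) .{{_ : NonZero b}} where

  digits : ℕ → ℕ → Word b
  digits zero    v = []
  digits (suc k) v = digits k (v / b) ++ [ v mod b ]

  length-digits : ∀ k v → length (digits k v) ≡ k
  length-digits zero    v = refl
  length-digits (suc k) v = trans (length-++ (digits k (v / b)))
    (trans (+-comm _ 1) (cong suc (length-digits k (v / b))))

  value-digits : ∀ k v → v < b ^ k → value (digits k v) ≡ v
  value-digits zero    zero    _          = refl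
  value-digits zero    (suc v) (s≤s ())
  value-digits (suc k) v v<b^k = begin
    value (digits k (v / b) ++ [ v mod b ])         ≡⟨ value-++ (digits k (v / b)) [ v mod b ] ⟩
    value (digits k (v / b)) * (b * 1) + toℕ (v mod b)
      ≡⟨ cong₂ (λ q r → q * (b * 1) + r) (value-digits k (v / b) quotient<) (toℕ-fromℕ< (m%n<n v b)) ⟩
    v / b * (b * 1) + v % b                         ≡⟨ cong (λ c → v / b * c + v % b) (*-identityʳ b) ⟩
    v / b * b + v % b                               ≡⟨ +-comm (v / b * b) (v % b) ⟩
    v % b + v / b * b                               ≡⟨ m≡m%n+[m/n]*n v b ⟨
    v                                               ∎
    where
    open ≡-Reasoning
    quotient< : v / b < b ^ k
    quotient< = m<n*o⇒m/o<n (subst (v <_) (*-comm b (b ^ k)) v<b^k)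

  isRep-digits-↑2 : ∀ k v → b ^ k < b * v → v < b ^ k → IsRep b (v * b ^ k + v) (digits k v ↑ 2)
  isRep-digits-↑2 k v lower upper = subst (λ m → IsRep b m (w ↑ 2)) value-w↑2 (isRep-↑2 w lower′)
    where
    w = digits k v
    value-w : value w ≡ v
    value-w = value-digits k v upper
    length-w : length w ≡ k
    length-w = length-digits k v
    lower′ : b ^ length w < b * value w
    lower′ = subst₂ (λ l u → b ^ l < b * u) (sym length-w) (sym value-w) lower
    value-w↑2 : value (w ↑ 2) ≡ v * b ^ k + v
    value-w↑2 = trans (value-↑2 w) (cong₂ (λ u l → u * b ^ l + u) value-w length-w)

suc-sq≤2*sq : ∀ {r} → 3 ≤ r → suc r * suc r ≤ 2 * (r * r)
suc-sq≤2*sq (s≤s (s≤s (s≤s {n = p} _))) =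
  subst ((4 + p) * (4 + p) ≤_) (sym (sq-doubled p)) (m≤m+n _ _)
  where
  sq-doubled : ∀ p → 2 * ((3 + p) * (3 + p)) ≡ (4 + p) * (4 + p) + (p * p + 4 * p + 2)
  sq-doubled = solve-∀

2+A*sq≤A*suc-sq : ∀ {A r} → 1 ≤ A → 1 ≤ r → 2 + A * (r * r) ≤ A * (suc r * suc r)
2+A*sq≤A*suc-sq {suc a} (s≤s z≤n) (s≤s {n = p} z≤n) =
  subst (2 + suc a * (suc p * suc p) ≤_) (sq-gap a p) (m≤m+n _ _)
  where
  sq-gap : ∀ a p →
    2 + suc a * (suc p * suc p) + (1 + 2 * p + a * (3 + 2 * p)) ≡ suc a * ((2 + p) * (2 + p))
  sq-gap = solve-∀

doubled-square : ∀ {b q} k → 2 ≤ b → 4 ≤ q → q * q ∣ b ^ k + 1 →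
  ∃ λ y → q ≤ y × Σ (Word b) λ w → IsRep b (y * y) (w ↑ 2)
doubled-square {b} k _ _ (divides zero eq) = contradiction eq (m+1+n≢0 (b ^ k))
doubled-square {b} {suc r} k 2≤b@(s≤s (s≤s _)) (s≤s 3≤r@(s≤s _)) (divides A@(suc _) eq) =
  y , m≤m*n (suc r) (A * r) , digits b k v ,
  subst (λ m → IsRep b m (digits b k v ↑ 2)) (sym y*y≡v*b^k+v) (isRep-digits-↑2 b k v lower upper)
  where
  v = A * (r * r)
  y = suc r * (A * r)
  y*y≡v*b^k+v : y * y ≡ v * b ^ k + v
  y*y≡v*b^k+v = begin
    y * y                        ≡⟨ regroup A r ⟩
    v * (A * (suc r * suc r))    ≡⟨ cong (v *_) eq ⟨
    v * (b ^ k + 1)              ≡⟨ *-distribˡ-+ v (b ^ k) 1 ⟩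
    v * b ^ k + v * 1            ≡⟨ cong (v * b ^ k +_) (*-identityʳ v) ⟩
    v * b ^ k + v                ∎
    where
    open ≡-Reasoning
    regroup : ∀ A r → suc r * (A * r) * (suc r * (A * r)) ≡ A * (r * r) * (A * (suc r * suc r))
    regroup = solve-∀
  lower : b ^ k < b * v
  lower = begin-strict
    b ^ k                      <⟨ m<m+n (b ^ k) (s≤s z≤n) ⟩
    b ^ k + 1                  ≡⟨ eq ⟩
    A * (suc r * suc r)        ≤⟨ *-monoʳ-≤ A (suc-sq≤2*sq 3≤r) ⟩
    A * (2 * (r * r))          ≡⟨ *-comm A (2 * (r * r)) ⟩
    2 * (r * r) * A            ≡⟨ *-assoc 2 (r * r) A ⟩
    2 * (r * r * A)            ≡⟨ cong (2 *_) (*-comm (r * r) A) ⟩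
    2 * v                      ≤⟨ *-monoˡ-≤ v 2≤b ⟩
    b * v                      ∎
    where open ≤-Reasoning
  upper : v < b ^ k
  upper = s≤s⁻¹ (begin
    2 + v                      ≤⟨ 2+A*sq≤A*suc-sq {A} (s≤s z≤n) (s≤s z≤n) ⟩
    A * (suc r * suc r)        ≡⟨ eq ⟨
    b ^ k + 1                  ≡⟨ +-comm (b ^ k) 1 ⟩
    suc (b ^ k)                ∎)
    where open ≤-Reasoning

infix 4 _≡_[mod_]

_≡_[mod_] : ℕ → ℕ → ℕ → Set
a ≡ c [mod n ] = ∃₂ λ s t → a + n * s ≡ c + n * t

∣-resp-≡[mod] : ∀ {d n a c} → d ∣ n → a ≡ c [mod n ] → d ∣ c → d ∣ a
∣-resp-≡[mod] {d} {n} {a} {c} d∣n (s , t , eq) d∣c =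
  ∣m+n∣m⇒∣n (subst (d ∣_) (trans (sym eq) (+-comm a (n * s))) d∣c+nt) (∣-trans d∣n (m∣m*n s))
  where
  d∣c+nt : d ∣ c + n * t
  d∣c+nt = ∣m∣n⇒∣m+n d∣c (∣-trans d∣n (m∣m*n t))

-- x² ≡ 1 − 2(x + 1) modulo (x + 1)², so multiplying by x² turns m (x + 1) into
-- (m + 2)(x + 1); both sides are shifted by x² so that no subtraction occurs.
pow+1-step : ∀ x m → x ^ m + 1 ≡ m * (x + 1) [mod (x + 1) * (x + 1) ] →
  x ^ (2 + m) + 1 ≡ (2 + m) * (x + 1) [mod (x + 1) * (x + 1) ]
pow+1-step x m (s , t , eq) =
  1 + x * x * s + 2 * m , m * (x + 1) + x * x * t , +-cancelʳ-≡ (x * x) _ _ (begin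
    x * (x * x ^ m) + 1 + c * c * (1 + x * x * s + 2 * m) + x * x
      ≡⟨ expand-lhs x m (x ^ m) s ⟩
    x * x * (x ^ m + 1 + c * c * s) + (1 + c * c + 2 * m * c * c)
      ≡⟨ cong (λ e → x * x * e + (1 + c * c + 2 * m * c * c)) eq ⟩
    x * x * (m * c + c * c * t) + (1 + c * c + 2 * m * c * c)
      ≡⟨ expand-rhs x m t ⟩
    (2 + m) * c + c * c * (m * c + x * x * t) + x * x ∎)
  where
  open ≡-Reasoning
  c = x + 1
  expand-lhs : ∀ x m X s → x * (x * X) + 1 + (x + 1) * (x + 1) * (1 + x * x * s + 2 * m) + x * x
    ≡ x * x * (X + 1 + (x + 1) * (x + 1) * s) + (1 + (x + 1) * (x + 1) + 2 * m * (x + 1) * (x + 1))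
  expand-lhs = solve-∀
  expand-rhs : ∀ x m t →
    x * x * (m * (x + 1) + (x + 1) * (x + 1) * t) + (1 + (x + 1) * (x + 1) + 2 * m * (x + 1) * (x + 1))
    ≡ (2 + m) * (x + 1) + (x + 1) * (x + 1) * (m * (x + 1) + x * x * t) + x * x
  expand-rhs = solve-∀

odd-pow+1≡[mod] : ∀ x j → x ^ suc (2 * j) + 1 ≡ suc (2 * j) * (x + 1) [mod (x + 1) * (x + 1) ]
odd-pow+1≡[mod] x zero    = 0 , 0 , base x
  where
  base : ∀ x → x * 1 + 1 + (x + 1) * (x + 1) * 0 ≡ 1 * (x + 1) + (x + 1) * (x + 1) * 0
  base = solve-∀
odd-pow+1≡[mod] x (suc j) =
  subst (λ m → x ^ suc m + 1 ≡ suc m * (x + 1) [mod (x + 1) * (x + 1) ]) (sym (*-suc 2 j))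
    (pow+1-step x (suc (2 * j)) (odd-pow+1≡[mod] x j))

sq∣odd-pow+1 : ∀ {q x} j → q ∣ x + 1 → q ∣ suc (2 * j) → q * q ∣ x ^ suc (2 * j) + 1
sq∣odd-pow+1 {x = x} j q∣x+1 q∣m =
  ∣-resp-≡[mod] (*-pres-∣ q∣x+1 q∣x+1) (odd-pow+1≡[mod] x j) (*-pres-∣ q∣m q∣x+1)

n*[1+n]-even : ∀ n → ∃ λ t → 2 * t ≡ n * suc n
n*[1+n]-even zero    = 0 , refl
n*[1+n]-even (suc n) with t , 2t≡n[n+1] ← n*[1+n]-even n = t + suc n , (begin
  2 * (t + suc n)            ≡⟨ *-distribˡ-+ 2 t (suc n) ⟩
  2 * t + 2 * suc n          ≡⟨ cong (_+ 2 * suc n) 2t≡n[n+1] ⟩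
  n * suc n + 2 * suc n      ≡⟨ *-distribʳ-+ (suc n) n 2 ⟨
  (n + 2) * suc n            ≡⟨ cong (_* suc n) (+-comm n 2) ⟩
  suc (suc n) * suc n        ≡⟨ *-comm (suc (suc n)) (suc n) ⟩
  suc n * suc (suc n)        ∎)
  where open ≡-Reasoning

-- z³ + 1 = (z + 1)(z² − z + 1), and z² − z + 1 = (z − 1) z + 1 is odd.
odd-divisor-of-cube+1 : ∀ {z} → 1 ≤ z → ∃ λ j → z ≤ suc (2 * j) × suc (2 * j) ∣ z ^ 3 + 1
odd-divisor-of-cube+1 {suc u} _ with j , 2j≡u[u+1] ← n*[1+n]-even u =
  j , s≤s (subst (u ≤_) (sym 2j≡u[u+1]) (m≤m*n u (suc u))) ,
  divides (2 + u) (trans (factor u) (cong (λ e → (2 + u) * suc e) (sym 2j≡u[u+1])))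
  where
  factor : ∀ u → suc u * (suc u * (suc u * 1)) + 1 ≡ (2 + u) * suc (u * suc u)
  factor = solve-∀

n<m^n : ∀ {m} → 1 < m → ∀ n → n < m ^ n
n<m^n 1<m zero    = s≤s z≤n
n<m^n {m} 1<m (suc n) = begin-strict
  suc n      ≤⟨ n<m^n 1<m n ⟩
  P          <⟨ m<m+n P (≤-<-trans z≤n (n<m^n 1<m n)) ⟩
  P + P      ≡⟨ cong (P +_) (+-identityʳ P) ⟨
  2 * P      ≤⟨ *-monoˡ-≤ P 1<m ⟩
  m * P      ∎
  where
  open ≤-Reasoning
  P = m ^ n

large-square-divisor-of-pow+1 : ∀ {b} → 2 ≤ b → ∀ n → ∃₂ λ q K → n < q × q * q ∣ b ^ K + 1
large-square-divisor-of-pow+1 {b} 2≤b n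
  with j , b^n≤q , q∣b^n³+1 ← odd-divisor-of-cube+1 (≤-trans (s≤s z≤n) (n<m^n 2≤b n)) =
  q , n * (3 * q) , <-≤-trans (n<m^n 2≤b n) b^n≤q ,
  subst (λ e → q * q ∣ e + 1) exponent (sq∣odd-pow+1 j q∣b^n³+1 ∣-refl)
  where
  q = suc (2 * j)
  exponent : ((b ^ n) ^ 3) ^ q ≡ b ^ (n * (3 * q))
  exponent = trans (^-*-assoc (b ^ n) 3 q) (^-*-assoc b n (3 * q))

mainTheorem5 : (b : ℕ) → b ≥ 2 →
    (N : ℕ) → Σ ℕ λ y → Σ (Word b) λ w →
      (y > N) × IsRep b (y * y) (w ↑ 2)
mainTheorem5 b 2≤b N =
  let q , K , 3+N<q , q²∣b^K+1 = large-square-divisor-of-pow+1 2≤b (3 + N)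
      y , q≤y , w , isRep      = doubled-square K 2≤b (m+n≤o⇒m≤o 4 3+N<q) q²∣b^K+1
  in  y , w , <-≤-trans (m+n≤o⇒n≤o 3 3+N<q) q≤y , isRep
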